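{- Let $(\Omega,S)$ be a regular thin Jordan scheme, fix $\omega_0\in\Omega$ and let $\diamond$ be as in the context. Then $(S,\diamond)$ is an alternative loop: for all $u,v\in S$, \[(u\diamond u)\diamond v=u\diamond(u\diamond v),\quad (v\diamond u)\diamond u=v\diamond(u\diamond u),\quad (u\diamond v)\diamond u=u\diamond(v\diamond u).\]
   Context: $\Omega$ is a finite nonempty set, $\mathbb{F}$ a field with $\mathrm{char}\,\mathbb{F}\neq2$, $A\star B=\tfrac12(AB+BA)$. A regular thin Jordan scheme $(\Omega,S)$ here means: $S$ is a set of permutations of $\Omega$, each regarded as the relation $\{(\omega,s(\omega))\}$, such that these relations partition $\Omega\times\Omega$, $1_\Omega\in S$, $s^{ -1}\in S$ for every $s\in S$, and the $\mathbb{F}$-span of the permutation matrices of the elements of $S$ is closed under $\star$. For fixed $\omega_0\in\Omega$ and $a,b\in S$, $a\diamond b$ is the unique $c\in S$ with $c(\omega_0)=a(b(\omega_0))$. -}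

module Defs where

open import Level using (Level; _⊔_) renaming (suc to lsuc)
open import Algebra.Bundles using (CommutativeRing)
open import Data.Nat.Base using (ℕ)
open import Data.Fin.Base using (Fin)
open import Data.Fin.Properties using (_≟_)
open import Data.Fin.Permutation using (Permutation′; _⟨$⟩ʳ_; _⟨$⟩ˡ_)
open import Data.Product using (Σ; ∃; _×_; proj₁)
open import Relation.Binary.PropositionalEquality using (_≡_)
open import Relation.Nullary using (¬_; yes; no)
import Algebra.Properties.Monoid.Sum as MonoidSum

record Field (c ℓ : Level) : Set (lsuc (c ⊔ ℓ)) where
  field
    commutativeRing : CommutativeRing c ℓ
  open CommutativeRing commutativeRing public
  field
    1≉0     : ¬ (1# ≈ 0#)
    inverse : ∀ x → ¬ (x ≈ 0#) → ∃ λ y → x * y ≈ 1#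

module MatrixDefs {c ℓ : Level} (F : Field c ℓ) where
  open Field F
  open MonoidSum +-monoid using (sum)

  Char≢2 : Set ℓ
  Char≢2 = ¬ ((1# + 1#) ≈ 0#)

  half : Char≢2 → Carrier
  half ch = proj₁ (inverse (1# + 1#) ch)

  Matrix : ℕ → Set c
  Matrix n = Fin n → Fin n → Carrier

  _·_ : ∀ {n} → Matrix n → Matrix n → Matrix n
  (A · B) x z = sum (λ y → A x y * B y z)

  _⊕_ : ∀ {n} → Matrix n → Matrix n → Matrix n
  (A ⊕ B) x y = A x y + B x y

  jordan : ∀ {n} → Char≢2 → Matrix n → Matrix n → Matrix n
  jordan ch A B x y = half ch * ((A · B) ⊕ (B · A)) x y

  -- permutation matrix of s, i.e. adjacency matrix of the relation {(ω, s ω)}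
  permMatrix : ∀ {n} → Permutation′ n → Matrix n
  permMatrix s x y with s ⟨$⟩ʳ x ≟ y
  ... | yes _ = 1#
  ... | no  _ = 0#

  lincomb : ∀ {n k} → (Fin k → Permutation′ n) → (Fin k → Carrier) → Matrix n
  lincomb s cs x y = sum (λ i → cs i * permMatrix (s i) x y)

  -- The partition condition says: for all ω, ω' there is exactly one index i
  -- with s i ω = ω' (so the relations of distinct indices are distinct and
  -- disjoint, and they cover Ω × Ω).
  record RegularThinJordanScheme (n k : ℕ) (ch : Char≢2) : Set (c ⊔ ℓ) where
    field
      s         : Fin k → Permutation′ n
      partition : ∀ x y → Σ (Fin k) λ i →
                    (s i ⟨$⟩ʳ x ≡ y) × (∀ j → s j ⟨$⟩ʳ x ≡ y → j ≡ i)
      hasId     : ∃ λ i → ∀ x → s i ⟨$⟩ʳ x ≡ x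
      hasInv    : ∀ i → ∃ λ j → ∀ x → s j ⟨$⟩ʳ x ≡ s i ⟨$⟩ˡ x
      jordanClosed : ∀ (a b : Fin k → Carrier) → ∃ λ (e : Fin k → Carrier) →
                    ∀ x y → jordan ch (lincomb s a) (lincomb s b) x y ≈ lincomb s e x y

    diamond : Fin n → Fin k → Fin k → Fin k
    diamond ω₀ a b = proj₁ (partition ω₀ (s a ⟨$⟩ʳ (s b ⟨$⟩ʳ ω₀)))

-- Write a ∙ x for the image of x under the permutation a.  The (x, z)-entry of the
-- Jordan product P_b ⋆ P_a is ½ times the number of hits of z among a ∙ b ∙ x and
-- b ∙ a ∙ x; closure under ⋆ makes it constant on every relation of the scheme, and
-- since char F ≠ 2 and the count is at most 2, so is the count.  Moving from x to ω₀
-- along a relation turns this into an equality of two-element multisets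
--   {(a ◇ b) ∙ x , (b ◇ a) ∙ x} = {a ∙ b ∙ x , b ∙ a ∙ x}   for every point x.
-- For a = b it gives (u ◇ u) ∙ x = u ∙ u ∙ x and the left alternative law.  Adding six
-- instances as multiplicity functions gives the Bol identity (u ◇ (v ◇ u)) ∙ x =
-- u ∙ v ∙ u ∙ x.  At x = u ∙ ω₀ the multiset identity says that either the flexible and
-- right alternative laws both hold, or they hold with right-hand sides swapped; in
-- the latter case u commutes with v ◇ u, and the Bol identity gives the right
-- alternative law, hence the flexible one.

module Submission where

open import Defs
open import Level using (Level)
open import Data.Nat.Base as Nat using (ℕ; suc; _≤_; s≤s; z≤n)
import Data.Nat.Properties as ℕ
open import Data.Nat.Tactic.RingSolver using (solve-∀)
open import Data.Fin.Base using (Fin; punchIn)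
open import Data.Fin.Properties using (_≟_; punchInᵢ≢i)
open import Data.Fin.Permutation using (_⟨$⟩ʳ_; _⟨$⟩ˡ_; inverseˡ)
open import Data.Product using (_×_; _,_; proj₁; proj₂)
open import Data.Sum using (_⊎_; inj₁; inj₂)
open import Data.Empty using (⊥-elim)
open import Function.Base using (_∘_)
open import Relation.Nullary using (yes; no)
open import Relation.Binary.PropositionalEquality
  using (_≡_; _≢_; _≗_; refl; sym; trans; cong; cong₂; module ≡-Reasoning)
import Algebra.Properties.CommutativeMonoid.Sum as CommutativeMonoidSum
import Algebra.Properties.Monoid.Mult as MonoidMult
import Algebra.Properties.Group as GroupProperties
import Relation.Binary.Reasoning.Setoid as SetoidReasoning

module _ {m : ℕ} where
  open Nat using (_+_)

  δ : Fin m → Fin m → ℕ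
  δ p q with p ≟ q
  ... | yes _ = 1
  ... | no  _ = 0

  δ-≡ : ∀ {p q} → p ≡ q → δ p q ≡ 1
  δ-≡ {p} {q} p≡q with p ≟ q
  ... | yes _   = refl
  ... | no  p≢q = ⊥-elim (p≢q p≡q)

  δ-≢ : ∀ {p q} → p ≢ q → δ p q ≡ 0
  δ-≢ {p} {q} p≢q with p ≟ q
  ... | yes p≡q = ⊥-elim (p≢q p≡q)
  ... | no  _   = refl

  δ≡suc⇒≡ : ∀ {p q j} → δ p q ≡ suc j → p ≡ q
  δ≡suc⇒≡ {p} {q} eq with p ≟ q
  ... | yes p≡q = p≡q
  ... | no  _ with () ← eq

  δ≤1 : ∀ p q → δ p q ≤ 1
  δ≤1 p q with p ≟ q
  ... | yes _ = s≤s z≤n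
  ... | no  _ = z≤n

  δ≗⇒≡ : ∀ {p q} → (∀ z → δ p z ≡ δ q z) → p ≡ q
  δ≗⇒≡ {q = q} eq = δ≡suc⇒≡ (trans (eq q) (δ-≡ refl))

  ⟅_,_⟆ : Fin m → Fin m → Fin m → ℕ
  ⟅ p , q ⟆ z = δ p z + δ q z

  ⟅⟆≤2 : ∀ p q z → ⟅ p , q ⟆ z ≤ 2
  ⟅⟆≤2 p q z = ℕ.+-mono-≤ (δ≤1 p z) (δ≤1 q z)

  infix 4 _≐_

  _≐_ : Fin m × Fin m → Fin m × Fin m → Set
  (p , q) ≐ (r , s) = (p ≡ r × q ≡ s) ⊎ (p ≡ s × q ≡ r)

  ≐⇒⟅⟆≗ : ∀ {p q r s} → (p , q) ≐ (r , s) → ⟅ p , q ⟆ ≗ ⟅ r , s ⟆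
  ≐⇒⟅⟆≗         (inj₁ (refl , refl)) _ = refl
  ≐⇒⟅⟆≗ {p} {q} (inj₂ (refl , refl)) z = ℕ.+-comm (δ p z) (δ q z)

  ⟅⟆≗⇒≐ : ∀ {p q r s} → ⟅ p , q ⟆ ≗ ⟅ r , s ⟆ → (p , q) ≐ (r , s)
  ⟅⟆≗⇒≐ {p} {q} {r} {s} eq with p ≟ r
  ... | yes refl = inj₁ (refl , δ≗⇒≡ (λ z → ℕ.+-cancelˡ-≡ (δ p z) _ _ (eq z)))
  ... | no  p≢r  = inj₂ (p≡s , δ≗⇒≡ λ z → ℕ.+-cancelˡ-≡ (δ p z) _ _ (begin
      δ p z + δ q z ≡⟨ eq z ⟩
      δ r z + δ s z ≡⟨ ℕ.+-comm (δ r z) _ ⟩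
      δ s z + δ r z ≡⟨ cong (λ t → δ t z + δ r z) (sym p≡s) ⟩
      δ p z + δ r z ∎))
    where
    open ≡-Reasoning
    p≡s : p ≡ s
    p≡s = sym (δ≡suc⇒≡ (begin
      δ s p             ≡⟨ sym (cong (_+ δ s p) (δ-≢ (p≢r ∘ sym))) ⟩
      δ r p + δ s p     ≡⟨ sym (eq p) ⟩
      δ p p + δ q p     ≡⟨ cong (_+ δ q p) (δ-≡ refl) ⟩
      suc (δ q p)       ∎))

  ≐-diag : ∀ {p r s} → (p , p) ≐ (r , s) → p ≡ r
  ≐-diag (inj₁ (p≡r , _)) = p≡r
  ≐-diag (inj₂ (_ , p≡r)) = p≡r

  ≐-resp : ∀ {p q r s p′ q′ r′ s′} → p ≡ p′ → q ≡ q′ → r ≡ r′ → s ≡ s′ →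
           (p , q) ≐ (r , s) → (p′ , q′) ≐ (r′ , s′)
  ≐-resp refl refl refl refl h = h

  -- on multiplicities, 2p₃ = 2t is h₁ + h₂ + h₄ + h₅ − h₃ − h₆
  ≐-linear-elimination : ∀ {p₁ p₂ p₃ p₄ p₅ q₁ q₂ q₃ q₄ r₁ r₂ t} →
    (p₁ , p₂) ≐ (q₁ , q₂) → (p₃ , p₄) ≐ (q₃ , q₄) → (p₁ , p₅) ≐ (r₁ , r₂) →
    (q₁ , q₃) ≐ (r₁ , t) → (q₂ , q₄) ≐ (t , r₂) → (p₂ , p₄) ≐ (p₃ , p₅) →
    p₃ ≡ t
  ≐-linear-elimination {p₁} {p₂} {p₃} {p₄} {p₅} {q₁} {q₂} {q₃} {q₄} {r₁} {r₂} {t}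
                       h₁ h₂ h₃ h₄ h₅ h₆ = ≐-diag (⟅⟆≗⇒≐ λ z →
    let open ≡-Reasoning
        [_] = λ a → δ a z
    in ℕ.+-cancelˡ-≡ ([ r₁ ] + [ r₂ ]) _ _ (begin
    ([ r₁ ] + [ r₂ ]) + ([ p₃ ] + [ p₃ ]) ≡⟨ cong (_+ ([ p₃ ] + [ p₃ ])) (sym (≐⇒⟅⟆≗ h₃ z)) ⟩
    ([ p₁ ] + [ p₅ ]) + ([ p₃ ] + [ p₃ ]) ≡⟨ shuffle₃ [ p₁ ] [ p₅ ] [ p₃ ] ⟩
    ([ p₁ ] + [ p₃ ]) + ([ p₃ ] + [ p₅ ]) ≡⟨ cong (([ p₁ ] + [ p₃ ]) +_) (sym (≐⇒⟅⟆≗ h₆ z)) ⟩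
    ([ p₁ ] + [ p₃ ]) + ([ p₂ ] + [ p₄ ]) ≡⟨ shuffle₄ [ p₁ ] [ p₃ ] [ p₂ ] [ p₄ ] ⟩
    ([ p₁ ] + [ p₂ ]) + ([ p₃ ] + [ p₄ ]) ≡⟨ cong₂ _+_ (≐⇒⟅⟆≗ h₁ z) (≐⇒⟅⟆≗ h₂ z) ⟩
    ([ q₁ ] + [ q₂ ]) + ([ q₃ ] + [ q₄ ]) ≡⟨ shuffle₄ [ q₁ ] [ q₂ ] [ q₃ ] [ q₄ ] ⟩
    ([ q₁ ] + [ q₃ ]) + ([ q₂ ] + [ q₄ ]) ≡⟨ cong₂ _+_ (≐⇒⟅⟆≗ h₄ z) (≐⇒⟅⟆≗ h₅ z) ⟩
    ([ r₁ ] + [ t ]) + ([ t ] + [ r₂ ])   ≡⟨ sym (shuffle₃ [ r₁ ] [ r₂ ] [ t ]) ⟩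
    ([ r₁ ] + [ r₂ ]) + ([ t ] + [ t ])   ∎))
    where
    shuffle₃ : ∀ a b c → (a + b) + (c + c) ≡ (a + c) + (c + b)
    shuffle₃ = solve-∀
    shuffle₄ : ∀ a b c d → (a + b) + (c + d) ≡ (a + c) + (b + d)
    shuffle₄ = solve-∀

module _ {m m′ : ℕ} (g : Fin m → Fin m′) where

  ≐-map : ∀ {p q r s} → (p , q) ≐ (r , s) → (g p , g q) ≐ (g r , g s)
  ≐-map (inj₁ (e₁ , e₂)) = inj₁ (cong g e₁ , cong g e₂)
  ≐-map (inj₂ (e₁ , e₂)) = inj₂ (cong g e₁ , cong g e₂)

  ≐-reflect : (∀ {a b} → g a ≡ g b → a ≡ b) →
              ∀ {p q r s} → (g p , g q) ≐ (g r , g s) → (p , q) ≐ (r , s)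
  ≐-reflect g-injective (inj₁ (e₁ , e₂)) = inj₁ (g-injective e₁ , g-injective e₂)
  ≐-reflect g-injective (inj₂ (e₁ , e₂)) = inj₂ (g-injective e₁ , g-injective e₂)

module _ {c ℓ : Level} (F : Field c ℓ) where
  open Field F hiding (zero)
    renaming (refl to ≈-refl; sym to ≈-sym; trans to ≈-trans)
  open MatrixDefs F
  open CommutativeMonoidSum +-commutativeMonoid
    using (sum; sum-remove; sum-cong-≋; sum-replicate-zero)
  open MonoidMult +-monoid using (×-congˡ; ×-homo-1; ×-homo-+)
    renaming (_×_ to _×ₘ_)
  open GroupProperties +-group using (∙-cancelˡ)
  open SetoidReasoning setoid

  sum-supported : ∀ {m} (h : Fin m → Carrier) (i : Fin m) →
                  (∀ j → j ≢ i → h j ≈ 0#) → sum h ≈ h i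
  sum-supported {suc m} h i vanish = begin
    sum h                          ≈⟨ sum-remove {i = i} h ⟩
    h i + sum (h ∘ punchIn i)      ≈⟨ +-congˡ (sum-cong-≋ (λ j → vanish _ (punchInᵢ≢i i j))) ⟩
    h i + sum {m} (λ _ → 0#)       ≈⟨ +-congˡ (sum-replicate-zero m) ⟩
    h i + 0#                       ≈⟨ +-identityʳ (h i) ⟩
    h i                            ∎

  δ×1#-≡ : ∀ {m} {p q : Fin m} → p ≡ q → δ p q ×ₘ 1# ≈ 1#
  δ×1#-≡ p≡q = ≈-trans (×-congˡ (δ-≡ p≡q)) (×-homo-1 1#)

  δ×1#-≢ : ∀ {m} {p q : Fin m} → p ≢ q → δ p q ×ₘ 1# ≈ 0#
  δ×1#-≢ p≢q = ×-congˡ (δ-≢ p≢q)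

  δ-weighted-sum : ∀ {m} (p : Fin m) (g : Fin m → Carrier) →
                   sum (λ j → δ p j ×ₘ 1# * g j) ≈ g p
  δ-weighted-sum p g = ≈-trans
    (sum-supported _ p (λ j j≢p → ≈-trans (*-congʳ (δ×1#-≢ (j≢p ∘ sym))) (zeroˡ (g j))))
    (≈-trans (*-congʳ (δ×1#-≡ {p = p} refl)) (*-identityˡ (g p)))

  module _ (ch : Char≢2) where

    ×1#≈0#⇒≡0 : ∀ {d} → d ≤ 2 → d ×ₘ 1# ≈ 0# → d ≡ 0
    ×1#≈0#⇒≡0 {0}                 _ _ = refl
    ×1#≈0#⇒≡0 {1}                 _ eq = ⊥-elim (1≉0 (≈-trans (≈-sym (+-identityʳ 1#)) eq))
    ×1#≈0#⇒≡0 {2}                 _ eq = ⊥-elim (ch (≈-trans (+-congˡ (≈-sym (+-identityʳ 1#))) eq))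
    ×1#≈0#⇒≡0 {suc (suc (suc _))} (s≤s (s≤s ())) _

    ×1#-injective-≤ : ∀ {m m′} → m ≤ m′ → m′ ≤ 2 → m ×ₘ 1# ≈ m′ ×ₘ 1# → m ≡ m′
    ×1#-injective-≤ {m} m≤m′ m′≤2 eq with ℕ.m≤n⇒∃[o]m+o≡n m≤m′
    ... | d , refl = sym (trans (cong (m Nat.+_) d≡0) (ℕ.+-identityʳ m))
      where
      d≡0 : d ≡ 0
      d≡0 = ×1#≈0#⇒≡0 (ℕ.≤-trans (ℕ.m≤n+m d m) m′≤2)
        (≈-sym (∙-cancelˡ (m ×ₘ 1#) 0# (d ×ₘ 1#)
          (≈-trans (+-identityʳ _) (≈-trans eq (×-homo-+ 1# m d)))))

    ×1#-injective : ∀ {m m′} → m ≤ 2 → m′ ≤ 2 → m ×ₘ 1# ≈ m′ ×ₘ 1# → m ≡ m′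
    ×1#-injective {m} {m′} m≤2 m′≤2 eq with ℕ.≤-total m m′
    ... | inj₁ m≤m′ = ×1#-injective-≤ m≤m′ m′≤2 eq
    ... | inj₂ m′≤m = sym (×1#-injective-≤ m′≤m m≤2 (≈-sym eq))

    half-cancel : ∀ {x y} → half ch * x ≈ half ch * y → x ≈ y
    half-cancel {x} {y} eq = begin
      x                          ≈⟨ *-identityˡ x ⟨
      1# * x                     ≈⟨ *-congʳ two*half≈1 ⟨
      ((1# + 1#) * half ch) * x  ≈⟨ *-assoc _ _ x ⟩
      (1# + 1#) * (half ch * x)  ≈⟨ *-congˡ eq ⟩
      (1# + 1#) * (half ch * y)  ≈⟨ *-assoc _ _ y ⟨
      ((1# + 1#) * half ch) * y  ≈⟨ *-congʳ two*half≈1 ⟩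
      1# * y                     ≈⟨ *-identityˡ y ⟩
      y                          ∎
      where
      two*half≈1 : (1# + 1#) * half ch ≈ 1#
      two*half≈1 = proj₂ (inverse (1# + 1#) ch)

module Scheme {c ℓ : Level} (F : Field c ℓ) (ch : MatrixDefs.Char≢2 F) {n k : ℕ}
               (X : MatrixDefs.RegularThinJordanScheme F n k ch) where
  open MatrixDefs F
  open RegularThinJordanScheme X

  infixr 5 _∙_

  _∙_ : Fin k → Fin n → Fin n
  a ∙ x = s a ⟨$⟩ʳ x

  cls : Fin n → Fin n → Fin k
  cls x y = proj₁ (partition x y)

  cls-∙ : ∀ x y → cls x y ∙ x ≡ y
  cls-∙ x y = proj₁ (proj₂ (partition x y))

  cls-unique : ∀ {a x y} → a ∙ x ≡ y → a ≡ cls x y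
  cls-unique {a} {x} {y} = proj₂ (proj₂ (partition x y)) a

  ∙-injectiveˡ : ∀ {a b x} → a ∙ x ≡ b ∙ x → a ≡ b
  ∙-injectiveˡ eq = trans (cls-unique eq) (sym (cls-unique refl))

  ∙-injectiveʳ : ∀ a {x y} → a ∙ x ≡ a ∙ y → x ≡ y
  ∙-injectiveʳ a {x} {y} eq =
    trans (sym (inverseˡ (s a))) (trans (cong (s a ⟨$⟩ˡ_) eq) (inverseˡ (s a)))

  δ-∙ : ∀ a b x → δ (a ∙ x) (b ∙ x) ≡ δ a b
  δ-∙ a b x with a ≟ b
  ... | yes refl = δ-≡ refl
  ... | no  a≢b  = δ-≢ (a≢b ∘ ∙-injectiveˡ)

  ⟅⟆-∙-cls : ∀ a b x y z → ⟅ a ∙ x , b ∙ x ⟆ z ≡ ⟅ a ∙ y , b ∙ y ⟆ (cls x z ∙ y)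
  ⟅⟆-∙-cls a b x y z = begin
    ⟅ a ∙ x , b ∙ x ⟆ z            ≡⟨ cong ⟅ a ∙ x , b ∙ x ⟆ (sym (cls-∙ x z)) ⟩
    ⟅ a ∙ x , b ∙ x ⟆ (e ∙ x)      ≡⟨ cong₂ Nat._+_ (transport a) (transport b) ⟩
    ⟅ a ∙ y , b ∙ y ⟆ (e ∙ y)      ∎
    where
    open ≡-Reasoning
    e = cls x z
    transport : ∀ c → δ (c ∙ x) (e ∙ x) ≡ δ (c ∙ y) (e ∙ y)
    transport c = trans (δ-∙ c e x) (sym (δ-∙ c e y))

  module _ where
    open Field F hiding (zero)
      renaming (refl to ≈-refl; sym to ≈-sym; trans to ≈-trans)
    open CommutativeMonoidSum +-commutativeMonoid using (sum; sum-cong-≋)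
    open MonoidMult +-monoid using (×-homo-+) renaming (_×_ to _×ₘ_)
    open SetoidReasoning setoid

    permMatrix-≡ : ∀ {a x y} → a ∙ x ≡ y → permMatrix (s a) x y ≈ 1#
    permMatrix-≡ {a} {x} {y} eq with a ∙ x ≟ y
    ... | yes _   = ≈-refl
    ... | no  neq = ⊥-elim (neq eq)

    permMatrix-≢ : ∀ {a x y} → a ∙ x ≢ y → permMatrix (s a) x y ≈ 0#
    permMatrix-≢ {a} {x} {y} neq with a ∙ x ≟ y
    ... | yes eq = ⊥-elim (neq eq)
    ... | no  _  = ≈-refl

    lincomb-thin : ∀ (e : Fin k → Carrier) x y → lincomb s e x y ≈ e (cls x y)
    lincomb-thin e x y = ≈-trans
      (sum-supported F _ (cls x y)
        (λ j j≢c → ≈-trans (*-congˡ (permMatrix-≢ (j≢c ∘ cls-unique))) (zeroʳ (e j))))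
      (≈-trans (*-congˡ (permMatrix-≡ (cls-∙ x y))) (*-identityʳ _))

    unit : Fin k → Fin k → Carrier
    unit a j = δ a j ×ₘ 1#

    lincomb-unit : ∀ a x y → lincomb s (unit a) x y ≈ δ (a ∙ x) y ×ₘ 1#
    lincomb-unit a x y = begin
      lincomb s (unit a) x y           ≈⟨ lincomb-thin (unit a) x y ⟩
      δ a (cls x y) ×ₘ 1#              ≡⟨ cong (_×ₘ 1#) (sym (δ-∙ a (cls x y) x)) ⟩
      δ (a ∙ x) (cls x y ∙ x) ×ₘ 1#    ≡⟨ cong (λ z → δ (a ∙ x) z ×ₘ 1#) (cls-∙ x y) ⟩
      δ (a ∙ x) y ×ₘ 1#                ∎

    lincomb-unit-· : ∀ a b x z →
      (lincomb s (unit b) · lincomb s (unit a)) x z ≈ δ (a ∙ (b ∙ x)) z ×ₘ 1#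
    lincomb-unit-· a b x z = begin
      sum (λ y → lincomb s (unit b) x y * lincomb s (unit a) y z)
        ≈⟨ sum-cong-≋ (λ y → *-congʳ (lincomb-unit b x y)) ⟩
      sum (λ y → δ (b ∙ x) y ×ₘ 1# * lincomb s (unit a) y z)
        ≈⟨ δ-weighted-sum F (b ∙ x) _ ⟩
      lincomb s (unit a) (b ∙ x) z
        ≈⟨ lincomb-unit a (b ∙ x) z ⟩
      δ (a ∙ (b ∙ x)) z ×ₘ 1#
        ∎

    jordan-unit : ∀ a b x z → jordan ch (lincomb s (unit b)) (lincomb s (unit a)) x z
                              ≈ half ch * (⟅ a ∙ (b ∙ x) , b ∙ (a ∙ x) ⟆ z ×ₘ 1#)
    jordan-unit a b x z = *-congˡ (≈-trans
      (+-cong (lincomb-unit-· a b x z) (lincomb-unit-· b a x z))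
      (≈-sym (×-homo-+ 1# (δ (a ∙ (b ∙ x)) z) _)))

    ⟅⟆-class-invariant : ∀ a b {x z x′ z′} → cls x z ≡ cls x′ z′ →
      ⟅ a ∙ (b ∙ x) , b ∙ (a ∙ x) ⟆ z ≡ ⟅ a ∙ (b ∙ x′) , b ∙ (a ∙ x′) ⟆ z′
    ⟅⟆-class-invariant a b {x} {z} {x′} {z′} same-class =
      ×1#-injective F ch (⟅⟆≤2 (a ∙ (b ∙ x)) _ z) (⟅⟆≤2 (a ∙ (b ∙ x′)) _ z′)
        (half-cancel F ch (begin
          half ch * (⟅ a ∙ (b ∙ x) , b ∙ (a ∙ x) ⟆ z ×ₘ 1#)       ≈⟨ jordan-unit a b x z ⟨
          jordan ch (lincomb s (unit b)) (lincomb s (unit a)) x z   ≈⟨ coefficient x z ⟩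
          e (cls x z)                                               ≡⟨ cong e same-class ⟩
          e (cls x′ z′)                                             ≈⟨ coefficient x′ z′ ⟨
          jordan ch (lincomb s (unit b)) (lincomb s (unit a)) x′ z′ ≈⟨ jordan-unit a b x′ z′ ⟩
          half ch * (⟅ a ∙ (b ∙ x′) , b ∙ (a ∙ x′) ⟆ z′ ×ₘ 1#)    ∎))
      where
      e : Fin k → Carrier
      e = proj₁ (jordanClosed (unit b) (unit a))
      coefficient : ∀ x z → jordan ch (lincomb s (unit b)) (lincomb s (unit a)) x z ≈ e (cls x z)
      coefficient x z = ≈-trans (proj₂ (jordanClosed (unit b) (unit a)) x z) (lincomb-thin e x z)

  module Diamond (ω₀ : Fin n) where

    _◇_ : Fin k → Fin k → Fin k
    _◇_ = diamond ω₀

    ◇-∙ω₀ : ∀ a b → (a ◇ b) ∙ ω₀ ≡ a ∙ (b ∙ ω₀)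
    ◇-∙ω₀ a b = cls-∙ ω₀ (a ∙ (b ∙ ω₀))

    ◇-≡ : ∀ {a b c d} → a ∙ (b ∙ ω₀) ≡ c ∙ (d ∙ ω₀) → a ◇ b ≡ c ◇ d
    ◇-≡ = cong (cls ω₀)

    ◇-∙-pair : ∀ a b x → ((a ◇ b) ∙ x , (b ◇ a) ∙ x) ≐ (a ∙ (b ∙ x) , b ∙ (a ∙ x))
    ◇-∙-pair a b x = ⟅⟆≗⇒≐ λ z → let e = cls x z in begin
      ⟅ (a ◇ b) ∙ x , (b ◇ a) ∙ x ⟆ z          ≡⟨ ⟅⟆-∙-cls (a ◇ b) (b ◇ a) x ω₀ z ⟩
      ⟅ (a ◇ b) ∙ ω₀ , (b ◇ a) ∙ ω₀ ⟆ (e ∙ ω₀)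
        ≡⟨ cong₂ (λ p q → ⟅ p , q ⟆ (e ∙ ω₀)) (◇-∙ω₀ a b) (◇-∙ω₀ b a) ⟩
      ⟅ a ∙ (b ∙ ω₀) , b ∙ (a ∙ ω₀) ⟆ (e ∙ ω₀) ≡⟨ ⟅⟆-class-invariant a b (cls-unique refl) ⟨
      ⟅ a ∙ (b ∙ x) , b ∙ (a ∙ x) ⟆ z          ∎
      where open ≡-Reasoning

    ◇-self-∙ : ∀ u x → (u ◇ u) ∙ x ≡ u ∙ (u ∙ x)
    ◇-self-∙ u x = ≐-diag (◇-∙-pair u u x)

    ◇-left-alternative : ∀ u v → (u ◇ u) ◇ v ≡ u ◇ (u ◇ v)
    ◇-left-alternative u v =
      ◇-≡ (trans (◇-self-∙ u (v ∙ ω₀)) (cong (u ∙_) (sym (◇-∙ω₀ u v))))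

    ◇-flexible-right-alternative-up-to-swap : ∀ u v →
      ((u ◇ v) ◇ u , (v ◇ u) ◇ u) ≐ (u ◇ (v ◇ u) , v ◇ (u ◇ u))
    ◇-flexible-right-alternative-up-to-swap u v = ≐-reflect (_∙ ω₀) ∙-injectiveˡ
      (≐-resp (sym (◇-∙ω₀ (u ◇ v) u)) (sym (◇-∙ω₀ (v ◇ u) u))
              (sym (trans (◇-∙ω₀ u (v ◇ u)) (cong (u ∙_) (◇-∙ω₀ v u))))
              (sym (trans (◇-∙ω₀ v (u ◇ u)) (cong (v ∙_) (◇-∙ω₀ u u))))
              (◇-∙-pair u v (u ∙ ω₀)))

    ◇-bol-∙ : ∀ u v x → (u ◇ (v ◇ u)) ∙ x ≡ u ∙ (v ∙ (u ∙ x))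
    ◇-bol-∙ u v x = ≐-linear-elimination
      (◇-∙-pair u (u ◇ v) x)
      (◇-∙-pair u (v ◇ u) x)
      (≐-resp (cong (_∙ x) (◇-left-alternative u v)) refl
              (◇-self-∙ u (v ∙ x)) (cong (v ∙_) (◇-self-∙ u x))
              (◇-∙-pair (u ◇ u) v x))
      (≐-map (u ∙_) (◇-∙-pair u v x))
      (◇-∙-pair u v (u ∙ x))
      (≐-map (_∙ x) (◇-flexible-right-alternative-up-to-swap u v))

    ◇-right-alternative×flexible : ∀ u v →
      (v ◇ u) ◇ u ≡ v ◇ (u ◇ u) × (u ◇ v) ◇ u ≡ u ◇ (v ◇ u)
    ◇-right-alternative×flexible u v with ◇-flexible-right-alternative-up-to-swap u v
    ... | inj₁ (flexible , right-alternative) = right-alternative , flexible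
    ... | inj₂ (uv·u≡v·uu , vu·u≡u·vu) =
      right-alternative , trans uv·u≡v·uu (trans (sym right-alternative) vu·u≡u·vu)
      where
      w = v ◇ u
      y = u ∙ ω₀
      u◇w-∙y : (u ◇ w) ∙ y ≡ u ∙ (w ∙ y)
      u◇w-∙y = ≐-diag (≐-resp refl (cong (_∙ y) vu·u≡u·vu) refl refl (◇-∙-pair u w y))
      right-alternative : w ◇ u ≡ v ◇ (u ◇ u)
      right-alternative = ◇-≡ (trans (∙-injectiveʳ u (trans (sym u◇w-∙y) (◇-bol-∙ u v y)))
                                     (cong (v ∙_) (sym (◇-∙ω₀ u u))))

proposition3p12 : ∀ {c ℓ : Level} (F : Field c ℓ) (ch : MatrixDefs.Char≢2 F)
    (n k : ℕ) (X : MatrixDefs.RegularThinJordanScheme F n k ch) (ω₀ : Fin n) →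
    let _◇_ = MatrixDefs.RegularThinJordanScheme.diamond X ω₀ in
    ∀ (u v : Fin k) →
      ((u ◇ u) ◇ v ≡ u ◇ (u ◇ v))
      × ((v ◇ u) ◇ u ≡ v ◇ (u ◇ u))
      × ((u ◇ v) ◇ u ≡ u ◇ (v ◇ u))
proposition3p12 F ch n k X ω₀ u v =
  ◇-left-alternative u v , ◇-right-alternative×flexible u v
  where open Scheme.Diamond F ch X ω₀
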